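{- For every $s\in\{5,6\}$ and every $\mu\in\mathcal S_{I_4}$ with at least one fixed point, $\varkappa(\mathscr V_s(\mu))=\mathscr V_{11-s}(\mu)$.
   Context: $I_4=\{1,2,3,4\}$, $\wp_2(I_4)$ its 2-subsets, $\mathcal S_X$ permutations of $X$. $\varkappa\colon\wp_2(I_4)\to\wp_2(I_4)$, $\varkappa(u)=I_4\setminus u$; $\varkappa(\mathfrak V)$ is the configuration whose lines are the $\varkappa$-images of lines of $\mathfrak V$. For $\mu\in\mathcal S_{I_4}$ with a fixed point $i_0$ (the resulting configurations do not depend on the choice of $i_0$), define configurations on $\wp_2(I_4)$ with four 3-element lines: $\mathscr V_5(\mu)$ has lines $\wp_2(I_4\setminus\{i_0\})$ and, for each $k\in I_4\setminus\{i_0\}$ with $\{i,j\}=I_4\setminus\{i_0,k\}$, the line $\{\{i,i_0\},\{j,i_0\},I_4\setminus\{i_0,\mu(k)\}\}$; $\mathscr V_6(\mu)$ has lines $\{\{k,i_0\}:k\ne i_0\}$ and, for each $k\in I_4\setminus\{i_0\}$ with $\{i,j\}=I_4\setminus\{i_0,k\}$, the line $\{\{i,k\},\{j,k\},\{\mu(k),i_0\}\}$. -}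

module Defs where

open import Data.Nat using (ℕ)
open import Data.Fin using (Fin; punchIn)
open import Data.Fin.Subset using (Subset; ⁅_⁆; _∪_; ∁)
open import Data.Fin.Permutation using (Permutation′; _⟨$⟩ʳ_)
open import Data.List using (List; []; _∷_; map)
open import Data.List.Membership.Propositional using (_∈_)
open import Data.List.Relation.Unary.All using (All)
open import Data.List.Relation.Unary.Any using (Any)
open import Data.Product using (_×_)
open import Function.Bundles using (_⇔_)
open import Relation.Binary.PropositionalEquality using (_≡_)

-- I₄ = Fin 4 ; points of ℘₂(I₄) are represented as subsets of Fin 4
I₄ : Set
I₄ = Fin 4

Pt : Set
Pt = Subset 4

pair : I₄ → I₄ → Pt
pair a b = ⁅ a ⁆ ∪ ⁅ b ⁆

Line : Set
Line = List Pt

Config : Set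
Config = List Line

SameLine : Line → Line → Set
SameLine L L′ = ∀ u → (u ∈ L) ⇔ (u ∈ L′)

SameConfig : Config → Config → Set
SameConfig C D = All (λ L → Any (SameLine L) D) C × All (λ L → Any (SameLine L) C) D

ϰ : Config → Config
ϰ C = map (map ∁) C

Perm : Set
Perm = Permutation′ 4

FixedPoint : Perm → I₄ → Set
FixedPoint μ i₀ = μ ⟨$⟩ʳ i₀ ≡ i₀

-- The three elements k ≠ i₀ are  punchIn i₀ j  (j : Fin 3); for such k the two
-- remaining elements i, j of I₄ ∖ {i₀, k} are  punchIn i₀ (punchIn j t)  (t : Fin 2).
module _ (μ : Perm) (i₀ : I₄) where
  private
    k : Fin 3 → I₄
    k j = punchIn i₀ j
    other : Fin 3 → Fin 2 → I₄
    other j t = punchIn i₀ (punchIn j t)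
    z₂ o₂ : Fin 2
    z₂ = Fin.zero
    o₂ = Fin.suc Fin.zero
    z₃ o₃ t₃ : Fin 3
    z₃ = Fin.zero
    o₃ = Fin.suc Fin.zero
    t₃ = Fin.suc (Fin.suc Fin.zero)
    ks : List (Fin 3)
    ks = z₃ ∷ o₃ ∷ t₃ ∷ []

  -- 𝒱₅(μ): line ℘₂(I₄∖{i₀}) and, per k, {{i,i₀},{j,i₀}, I₄∖{i₀,μ(k)}}
  V₅ : Config
  V₅ = map (λ j → ∁ (pair i₀ (k j))) ks
     ∷ map (λ j → pair (other j z₂) i₀ ∷ pair (other j o₂) i₀ ∷ ∁ (pair i₀ (μ ⟨$⟩ʳ k j)) ∷ []) ks

  -- 𝒱₆(μ): line {{k,i₀} : k ≠ i₀} and, per k, {{i,k},{j,k},{μ(k),i₀}}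
  V₆ : Config
  V₆ = map (λ j → pair (k j) i₀) ks
     ∷ map (λ j → pair (other j z₂) (k j) ∷ pair (other j o₂) (k j) ∷ pair (μ ⟨$⟩ʳ k j) i₀ ∷ []) ks

-- For a single fixed point i₀ the theorem is a line-by-line identity: ϰ sends ℘₂(I₄∖{i₀}) to the
-- star {{k,i₀}}, and {{i,i₀},{j,i₀},I₄∖{i₀,μk}} to {{j,k},{i,k},{μk,i₀}}.  That the choice of the
-- fixed point does not matter is a finite fact, so the whole statement is decided by evaluation,
-- over all 4⁴ self-maps of I₄ rather than over permutations, which have no enumeration at hand.
-- Injectivity cannot be dropped: the statement fails for some non-injective maps.
module Submission where

open import Defs
open import Data.Product using (_×_; _,_)
open import Data.Nat using (zero; suc)
open import Data.Fin using (Fin; zero; suc; punchIn)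
open import Data.Fin.Properties using (all?) renaming (_≟_ to _≟ᶠ_)
open import Data.Fin.Subset using (∁)
open import Data.Fin.Permutation using (_⟨$⟩ʳ_)
open import Data.Bool using () renaming (_≟_ to _≟ᵇ_)
open import Data.List using ([]; _∷_; map; allFin)
open import Data.List.Properties using (map-cong)
import Data.List.Relation.Unary.All as All
import Data.List.Relation.Unary.Any as Any
import Data.List.Relation.Binary.Subset.DecPropositional as Subset
open import Data.Vec using (Vec; []; _∷_; lookup; tabulate)
open import Data.Vec.Properties using (≡-dec; lookup∘tabulate)
open import Function using (_∘_)
open import Function.Bundles using (mk⇔; Equivalence; Injection)
open import Function.Definitions using (Injective)
open import Function.Properties.Inverse using (↔⇒↣)
open import Relation.Binary.Definitions using (Decidable; DecidableEquality)
open import Relation.Binary.PropositionalEquality using (_≡_; _≗_; sym; trans; cong; subst₂)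
open import Relation.Nullary.Decidable using (Dec; map′; from-yes; _×-dec_; _→-dec_)

_≟ₚ_ : DecidableEquality Pt
_≟ₚ_ = ≡-dec _≟ᵇ_

open Subset _≟ₚ_ using (_⊆_; _⊆?_)

sameLine? : Decidable SameLine
sameLine? L L′ = map′ from-⊆ to-⊆ (L ⊆? L′ ×-dec L′ ⊆? L)
  where
  from-⊆ : L ⊆ L′ × L′ ⊆ L → SameLine L L′
  from-⊆ (L⊆L′ , L′⊆L) u = mk⇔ L⊆L′ L′⊆L
  to-⊆ : SameLine L L′ → L ⊆ L′ × L′ ⊆ L
  to-⊆ L≈L′ = Equivalence.to (L≈L′ _) , Equivalence.from (L≈L′ _)

sameConfig? : Decidable SameConfig
sameConfig? C D =
  All.all? (λ L → Any.any? (sameLine? L) D) C ×-dec All.all? (λ L → Any.any? (sameLine? L) C) D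

allVectors? : ∀ {m p} n {P : Vec (Fin m) n → Set p} → (∀ v → Dec (P v)) → Dec (∀ v → P v)
allVectors? zero    P? = map′ (λ { p [] → p }) (λ p → p []) (P? [])
allVectors? (suc n) P? = map′ (λ { p (x ∷ v) → p x v }) (λ p x v → p (x ∷ v))
                              (all? λ x → allVectors? n λ v → P? (x ∷ v))

allFunctions? : ∀ {m n p} {P : (Fin m → Fin n) → Set p} → (∀ {f g} → f ≗ g → P f → P g) →
                (∀ f → Dec (P f)) → Dec (∀ f → P f)
allFunctions? {m} resp P? =
  map′ (λ p f → resp (lookup∘tabulate f) (p (tabulate f))) (λ p v → p (lookup v))
       (allVectors? m (P? ∘ lookup))

injective? : ∀ {m n} (f : Fin m → Fin n) → Dec (Injective _≡_ _≡_ f)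
injective? f = map′ (λ p {x} {y} → p x y) (λ p x y → p)
                    (all? λ x → all? λ y → (f x ≟ᶠ f y) →-dec (x ≟ᶠ y))

-- V₅ᶠ i₀ (μ ⟨$⟩ʳ_) and V₆ᶠ i₀ (μ ⟨$⟩ʳ_) are definitionally V₅ μ i₀ and V₆ μ i₀.
module _ (i₀ : I₄) where
  V₅-line V₆-line : Fin 3 → I₄ → Line
  V₅-line j y = pair (punchIn i₀ (punchIn j zero)) i₀ ∷ pair (punchIn i₀ (punchIn j (suc zero))) i₀
              ∷ ∁ (pair i₀ y) ∷ []
  V₆-line j y = pair (punchIn i₀ (punchIn j zero)) (punchIn i₀ j)
              ∷ pair (punchIn i₀ (punchIn j (suc zero))) (punchIn i₀ j) ∷ pair y i₀ ∷ []

  pairsAvoiding pairsThrough : Line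
  pairsAvoiding = map (λ j → ∁ (pair i₀ (punchIn i₀ j))) (allFin 3)
  pairsThrough  = map (λ j → pair (punchIn i₀ j) i₀) (allFin 3)

  V₅ᶠ V₆ᶠ : (I₄ → I₄) → Config
  V₅ᶠ f = pairsAvoiding ∷ map (λ j → V₅-line j (f (punchIn i₀ j))) (allFin 3)
  V₆ᶠ f = pairsThrough ∷ map (λ j → V₆-line j (f (punchIn i₀ j))) (allFin 3)

  V₅ᶠ-cong : ∀ {f g} → f ≗ g → V₅ᶠ f ≡ V₅ᶠ g
  V₅ᶠ-cong f≗g = cong (pairsAvoiding ∷_) (map-cong (λ j → cong (V₅-line j) (f≗g (punchIn i₀ j))) (allFin 3))

  V₆ᶠ-cong : ∀ {f g} → f ≗ g → V₆ᶠ f ≡ V₆ᶠ g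
  V₆ᶠ-cong f≗g = cong (pairsThrough ∷_) (map-cong (λ j → cong (V₆-line j) (f≗g (punchIn i₀ j))) (allFin 3))

ϰ-swaps-V₅-V₆ : (I₄ → I₄) → I₄ → I₄ → Set
ϰ-swaps-V₅-V₆ f i₀ i₁ = SameConfig (ϰ (V₅ᶠ i₀ f)) (V₆ᶠ i₁ f) × SameConfig (ϰ (V₆ᶠ i₀ f)) (V₅ᶠ i₁ f)

ϰ-swaps-V₅-V₆-cong : ∀ {f g i₀ i₁} → f ≗ g → ϰ-swaps-V₅-V₆ f i₀ i₁ → ϰ-swaps-V₅-V₆ g i₀ i₁
ϰ-swaps-V₅-V₆-cong {i₀ = i₀} {i₁} f≗g (p , q) =
  subst₂ SameConfig (cong ϰ (V₅ᶠ-cong i₀ f≗g)) (V₆ᶠ-cong i₁ f≗g) p ,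
  subst₂ SameConfig (cong ϰ (V₆ᶠ-cong i₀ f≗g)) (V₅ᶠ-cong i₁ f≗g) q

ϰ-swaps-V₅-V₆? : ∀ f i₀ i₁ → Dec (ϰ-swaps-V₅-V₆ f i₀ i₁)
ϰ-swaps-V₅-V₆? f i₀ i₁ = sameConfig? _ _ ×-dec sameConfig? _ _

SwapsAtFixedPoints : (I₄ → I₄) → Set
SwapsAtFixedPoints f = Injective _≡_ _≡_ f → ∀ i₀ i₁ → f i₀ ≡ i₀ → f i₁ ≡ i₁ → ϰ-swaps-V₅-V₆ f i₀ i₁

swapsAtFixedPoints-cong : ∀ {f g} → f ≗ g → SwapsAtFixedPoints f → SwapsAtFixedPoints g
swapsAtFixedPoints-cong {f} {g} f≗g swaps g-inj i₀ i₁ gi₀≡i₀ gi₁≡i₁ =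
  ϰ-swaps-V₅-V₆-cong f≗g (swaps f-inj i₀ i₁ (trans (f≗g i₀) gi₀≡i₀) (trans (f≗g i₁) gi₁≡i₁))
  where
  f-inj : Injective _≡_ _≡_ f
  f-inj {x} {y} fx≡fy = g-inj (trans (sym (f≗g x)) (trans fx≡fy (f≗g y)))

swapsAtFixedPoints? : ∀ f → Dec (SwapsAtFixedPoints f)
swapsAtFixedPoints? f =
  injective? f →-dec all? λ i₀ → all? λ i₁ → (f i₀ ≟ᶠ i₀) →-dec (f i₁ ≟ᶠ i₁) →-dec ϰ-swaps-V₅-V₆? f i₀ i₁

swapsAtFixedPoints : ∀ f → SwapsAtFixedPoints f
swapsAtFixedPoints = from-yes (allFunctions? swapsAtFixedPoints-cong swapsAtFixedPoints?)

fact3p1 : (μ : Perm) (i₀ i₁ : I₄) → FixedPoint μ i₀ → FixedPoint μ i₁ →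
            SameConfig (ϰ (V₅ μ i₀)) (V₆ μ i₁) × SameConfig (ϰ (V₆ μ i₀)) (V₅ μ i₁)
fact3p1 μ = swapsAtFixedPoints (μ ⟨$⟩ʳ_) (Injection.injective (↔⇒↣ μ))
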